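{- Let $A\in\mathrm{GL}_2(\mathbb{Q})$. The following are equivalent: (a) $\dfrac{(\operatorname{tr}A)^2}{\det A}$ is an integer; (b) there exists an integer $n\ge1$ such that $A^n=rB$ for some $r\in\mathbb{Q}$ and some $B\in\mathrm{GL}_2(\mathbb{Z})$. -}

module Defs where

open import Data.Nat using (ℕ; zero; suc)
open import Data.Integer as ℤ using (ℤ)
open import Data.Rational as ℚ using (ℚ; 0ℚ; 1ℚ; _÷_; ≢-nonZero)
open import Data.Product using (∃; _×_)
open import Data.Sum using (_⊎_)
open import Relation.Binary.PropositionalEquality using (_≡_; _≢_)

record M2 (X : Set) : Set where
  constructor mat
  field
    a b c d : X

open M2 public

_*ₘ_ : M2 ℚ → M2 ℚ → M2 ℚ
mat a₁ b₁ c₁ d₁ *ₘ mat a₂ b₂ c₂ d₂ =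
  mat (a₁ ℚ.* a₂ ℚ.+ b₁ ℚ.* c₂) (a₁ ℚ.* b₂ ℚ.+ b₁ ℚ.* d₂)
      (c₁ ℚ.* a₂ ℚ.+ d₁ ℚ.* c₂) (c₁ ℚ.* b₂ ℚ.+ d₁ ℚ.* d₂)

Iₘ : M2 ℚ
Iₘ = mat 1ℚ 0ℚ 0ℚ 1ℚ

_^ₘ_ : M2 ℚ → ℕ → M2 ℚ
A ^ₘ zero  = Iₘ
A ^ₘ suc n = A *ₘ (A ^ₘ n)

_•ₘ_ : ℚ → M2 ℚ → M2 ℚ
r •ₘ mat a₁ b₁ c₁ d₁ = mat (r ℚ.* a₁) (r ℚ.* b₁) (r ℚ.* c₁) (r ℚ.* d₁)

tr : M2 ℚ → ℚ
tr (mat a₁ _ _ d₁) = a₁ ℚ.+ d₁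

det : M2 ℚ → ℚ
det (mat a₁ b₁ c₁ d₁) = a₁ ℚ.* d₁ ℚ.- b₁ ℚ.* c₁

InGL2ℚ : M2 ℚ → Set
InGL2ℚ A = det A ≢ 0ℚ

trSqOverDet : (A : M2 ℚ) → InGL2ℚ A → ℚ
trSqOverDet A h = _÷_ (tr A ℚ.* tr A) (det A) {{≢-nonZero h}}

IsInteger : ℚ → Set
IsInteger q = ∃ λ (z : ℤ) → q ≡ (z ℚ./ 1)

detℤ : M2 ℤ → ℤ
detℤ (mat a₁ b₁ c₁ d₁) = a₁ ℤ.* d₁ ℤ.- b₁ ℤ.* c₁

InGL2ℤ : M2 ℤ → Set
InGL2ℤ B = detℤ B ≡ ℤ.1ℤ ⊎ detℤ B ≡ ℤ.-1ℤ

toℚₘ : M2 ℤ → M2 ℚ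
toℚₘ (mat a₁ b₁ c₁ d₁) = mat ((a₁ ℚ./ 1)) ((b₁ ℚ./ 1)) ((c₁ ℚ./ 1)) ((d₁ ℚ./ 1))

{-# OPTIONS --safe #-}
-- Let C = A² / det A. Then det C = 1 and (tr A)² / det A = tr C + 2, and A²ⁿ = (det A)ⁿ Cⁿ, so both
-- conditions can be read off the powers of C. By Cayley–Hamilton, Cⁿ⁺¹ = Uₙ₊₁ C − Uₙ I and
-- tr Cⁿ = Vₙ, where U and V are the Lucas sequences of (tr C, 1).
-- If tr C is an integer, U is an integer sequence which (as det C = 1) is purely periodic modulo
-- the common denominator N of the entries of C; hence N ∣ Uₘ₊₁ for some m, and Cᵐ⁺¹ is an
-- integral matrix of determinant 1.
-- Conversely, if Aⁿ = r B with B ∈ GL₂(ℤ), then Cⁿ = k B² for a scalar k with k² = det Cⁿ = 1,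
-- so tr Cⁿ = Vₙ(tr C, 1) is an integer; writing tr C = p / q in lowest terms,
-- qⁿ Vₙ(p / q, 1) = Vₙ(p, q²) ≡ pⁿ (mod q), which forces q = 1.
module Submission where

open import Defs
open import Level using (0ℓ)
open import Algebra.Bundles using (CommutativeRing)
open import Algebra.Bundles.Raw using (RawRing)
open import Data.Nat as ℕ using (ℕ; zero; suc; _≥_; s≤s; z≤n)
import Data.Nat.Properties as ℕP
import Data.Nat.Divisibility as ℕD
import Data.Nat.Coprimality as ℕC
open import Data.Integer as ℤ using (ℤ; +_; _%ℕ_; _/ℕ_)
import Data.Integer.Properties as ℤP
open import Data.Integer.DivMod using (a≡a%ℕn+[a/ℕn]*n; n%ℕd<d)
open import Data.Integer.Divisibility.Signed
import Data.Integer.Divisibility as ℤᵘ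
open import Data.Integer.Coprimality using (Coprime; coprime-divisor)
import Data.Integer.Tactic.RingSolver as ℤ-Solver
open import Data.Rational as ℚ using (ℚ; 0ℚ; 1ℚ; mkℚ; ↥_; ↧_; ↧ₙ_; _/_; _+_; _*_; _-_; -_; 1/_; ≢-nonZero)
import Data.Rational.Properties as ℚP
import Data.Rational.Unnormalised as ℚᵘ
open import Algebra.Properties.CommutativeSemiring.Exp
  (CommutativeRing.commutativeSemiring ℚP.+-*-commutativeRing) using (_^_)
open import Data.Fin using (Fin; toℕ; fromℕ<; combine)
import Data.Fin.Properties as FinP
open import Data.Product using (∃; ∃₂; _×_; _,_; proj₁; proj₂)
open import Data.Sum using (inj₁; inj₂)
open import Function.Base using (_∘_)
open import Function.Bundles using (_⇔_; mk⇔; Equivalence)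
open import Relation.Nullary.Decidable using (dec⇒maybe; recompute)
open import Relation.Binary.PropositionalEquality
open import Tactic.RingSolver using (solve-∀)
open import Tactic.RingSolver.Core.AlmostCommutativeRing using (AlmostCommutativeRing; fromCommutativeRing)
open ≡-Reasoning

ℚ-ring : AlmostCommutativeRing 0ℓ 0ℓ
ℚ-ring = fromCommutativeRing ℚP.+-*-commutativeRing (λ x → dec⇒maybe (0ℚ ℚP.≟ x))

fromℤ : ℤ → ℚ
fromℤ i = i / 1

fromℤ≡mkℚ : ∀ i → fromℤ i ≡ mkℚ i 0 (ℕC.sym (ℕC.1-coprimeTo ℤ.∣ i ∣))
fromℤ≡mkℚ i = ℚP.↥p/↧p≡p _

fromℤ-injective : ∀ {i j} → fromℤ i ≡ fromℤ j → i ≡ j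
fromℤ-injective {i} {j} eq = cong ↥_ (trans (sym (fromℤ≡mkℚ i)) (trans eq (fromℤ≡mkℚ j)))

fromℤ-homo-+ : ∀ i j → fromℤ (i ℤ.+ j) ≡ fromℤ i + fromℤ j
fromℤ-homo-+ i j rewrite fromℤ≡mkℚ i | fromℤ≡mkℚ j =
  sym (ℚP./-cong (cong₂ ℤ._+_ (ℤP.*-identityʳ i) (ℤP.*-identityʳ j)) refl)

fromℤ-homo-* : ∀ i j → fromℤ (i ℤ.* j) ≡ fromℤ i * fromℤ j
fromℤ-homo-* i j rewrite fromℤ≡mkℚ i | fromℤ≡mkℚ j = refl

fromℤ-homo‿- : ∀ i → fromℤ (ℤ.- i) ≡ - fromℤ i
fromℤ-homo‿- i rewrite fromℤ≡mkℚ i | fromℤ≡mkℚ (ℤ.- i) = neg-mkℚ i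
  where
  neg-mkℚ : ∀ i → mkℚ (ℤ.- i) 0 (ℕC.sym (ℕC.1-coprimeTo ℤ.∣ ℤ.- i ∣)) ≡ - mkℚ i 0 (ℕC.sym (ℕC.1-coprimeTo ℤ.∣ i ∣))
  neg-mkℚ (+ zero)   = refl
  neg-mkℚ (+ suc n)  = refl
  neg-mkℚ ℤ.-[1+ n ] = refl

*-fromℤ-↧≡fromℤ-↥ : ∀ r → r * fromℤ (↧ r) ≡ fromℤ (↥ r)
*-fromℤ-↧≡fromℤ-↥ (mkℚ n d _) rewrite fromℤ≡mkℚ (+ suc d) =
  ℚP.fromℚᵘ-cong {ℚᵘ.mkℚᵘ (n ℤ.* + suc d) (d ℕ.* 1)} {ℚᵘ.mkℚᵘ n 0}
    (ℚᵘ.*≡* (trans (ℤP.*-identityʳ _) (cong (λ k → n ℤ.* + suc k) (sym (ℕP.*-identityʳ d)))))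

IsInteger-fromℤ : ∀ i → IsInteger (fromℤ i)
IsInteger-fromℤ i = i , refl

IsInteger-+ : ∀ {x y} → IsInteger x → IsInteger y → IsInteger (x + y)
IsInteger-+ (i , refl) (j , refl) = i ℤ.+ j , sym (fromℤ-homo-+ i j)

IsInteger-neg : ∀ {x} → IsInteger x → IsInteger (- x)
IsInteger-neg (i , refl) = ℤ.- i , sym (fromℤ-homo‿- i)

IsInteger-* : ∀ {x y} → IsInteger x → IsInteger y → IsInteger (x * y)
IsInteger-* (i , refl) (j , refl) = i ℤ.* j , sym (fromℤ-homo-* i j)

↧∣⇒IsInteger-* : ∀ r {k} → ↧ r ∣ k → IsInteger (fromℤ k * r)
↧∣⇒IsInteger-* r (divides w refl) = w ℤ.* ↥ r , (begin
  fromℤ (w ℤ.* ↧ r) * r        ≡⟨ cong (_* r) (fromℤ-homo-* w (↧ r)) ⟩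
  fromℤ w * fromℤ (↧ r) * r    ≡⟨ reassoc (fromℤ w) (fromℤ (↧ r)) r ⟩
  fromℤ w * (r * fromℤ (↧ r))  ≡⟨ cong (fromℤ w *_) (*-fromℤ-↧≡fromℤ-↥ r) ⟩
  fromℤ w * fromℤ (↥ r)        ≡⟨ sym (fromℤ-homo-* w (↥ r)) ⟩
  fromℤ (w ℤ.* ↥ r)            ∎)
  where
  reassoc : ∀ x y z → x * y * z ≡ x * (z * y)
  reassoc = solve-∀ ℚ-ring

↧ₙ≡1⇒IsInteger : ∀ r → ↧ₙ r ≡ 1 → IsInteger r
↧ₙ≡1⇒IsInteger r@(mkℚ p 0 _) refl = p , sym (ℚP.↥p/↧p≡p r)

infixl 6 _-ₘ_

_-ₘ_ : M2 ℚ → M2 ℚ → M2 ℚ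
mat a₁ b₁ c₁ d₁ -ₘ mat a₂ b₂ c₂ d₂ = mat (a₁ - a₂) (b₁ - b₂) (c₁ - c₂) (d₁ - d₂)

mat-cong : ∀ {X : Set} {a b c d a′ b′ c′ d′ : X} →
           a ≡ a′ → b ≡ b′ → c ≡ c′ → d ≡ d′ → mat a b c d ≡ mat a′ b′ c′ d′
mat-cong refl refl refl refl = refl

*ₘ-assoc : ∀ M N P → (M *ₘ N) *ₘ P ≡ M *ₘ (N *ₘ P)
*ₘ-assoc (mat a b c d) (mat e f g h) (mat i j k l) =
  mat-cong (entry a b e f g h i k) (entry a b e f g h j l) (entry c d e f g h i k) (entry c d e f g h j l)
  where
  entry : ∀ a b e f g h i k →
    (a * e + b * g) * i + (a * f + b * h) * k ≡ a * (e * i + f * k) + b * (g * i + h * k)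
  entry = solve-∀ ℚ-ring

*ₘ-identityˡ : ∀ M → Iₘ *ₘ M ≡ M
*ₘ-identityˡ (mat a b c d) = mat-cong (top a c) (top b d) (bottom a c) (bottom b d)
  where
  top : ∀ x y → 1ℚ * x + 0ℚ * y ≡ x
  top = solve-∀ ℚ-ring
  bottom : ∀ x y → 0ℚ * x + 1ℚ * y ≡ y
  bottom = solve-∀ ℚ-ring

•ₘ-*ₘ-•ₘ : ∀ k l M N → (k •ₘ M) *ₘ (l •ₘ N) ≡ (k * l) •ₘ (M *ₘ N)
•ₘ-*ₘ-•ₘ k l (mat a b c d) (mat e f g h) =
  mat-cong (entry k l a b e g) (entry k l a b f h) (entry k l c d e g) (entry k l c d f h)
  where
  entry : ∀ k l a b e g → (k * a) * (l * e) + (k * b) * (l * g) ≡ (k * l) * (a * e + b * g)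
  entry = solve-∀ ℚ-ring

•ₘ-assoc : ∀ k l M → k •ₘ (l •ₘ M) ≡ (k * l) •ₘ M
•ₘ-assoc k l (mat a b c d) = mat-cong (assoc a) (assoc b) (assoc c) (assoc d)
  where
  assoc : ∀ x → k * (l * x) ≡ (k * l) * x
  assoc x = sym (ℚP.*-assoc k l x)

•ₘ-identityˡ : ∀ M → 1ℚ •ₘ M ≡ M
•ₘ-identityˡ (mat a b c d) =
  mat-cong (ℚP.*-identityˡ a) (ℚP.*-identityˡ b) (ℚP.*-identityˡ c) (ℚP.*-identityˡ d)

det-*ₘ : ∀ M N → det (M *ₘ N) ≡ det M * det N
det-*ₘ (mat a b c d) (mat e f g h) = identity a b c d e f g h
  where
  identity : ∀ a b c d e f g h →
    (a * e + b * g) * (c * f + d * h) - (a * f + b * h) * (c * e + d * g)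
      ≡ (a * d - b * c) * (e * h - f * g)
  identity = solve-∀ ℚ-ring

det-•ₘ : ∀ k M → det (k •ₘ M) ≡ (k * k) * det M
det-•ₘ k (mat a b c d) = identity k a b c d
  where
  identity : ∀ k a b c d → (k * a) * (k * d) - (k * b) * (k * c) ≡ (k * k) * (a * d - b * c)
  identity = solve-∀ ℚ-ring

tr-•ₘ : ∀ k M → tr (k •ₘ M) ≡ k * tr M
tr-•ₘ k (mat a _ _ d) = sym (ℚP.*-distribˡ-+ k a d)

^ₘ-+ : ∀ A m n → A ^ₘ (m ℕ.+ n) ≡ (A ^ₘ m) *ₘ (A ^ₘ n)
^ₘ-+ A zero    n = sym (*ₘ-identityˡ (A ^ₘ n))
^ₘ-+ A (suc m) n = trans (cong (A *ₘ_) (^ₘ-+ A m n)) (sym (*ₘ-assoc A (A ^ₘ m) (A ^ₘ n)))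

*ₘ-self-^ₘ : ∀ A n → (A *ₘ A) ^ₘ n ≡ A ^ₘ (n ℕ.+ n)
*ₘ-self-^ₘ A zero    = refl
*ₘ-self-^ₘ A (suc n) = begin
  (A *ₘ A) *ₘ ((A *ₘ A) ^ₘ n)      ≡⟨ *ₘ-assoc A A _ ⟩
  A *ₘ (A *ₘ ((A *ₘ A) ^ₘ n))      ≡⟨ cong (λ P → A *ₘ (A *ₘ P)) (*ₘ-self-^ₘ A n) ⟩
  A ^ₘ suc (suc (n ℕ.+ n))         ≡⟨ cong (λ k → A ^ₘ suc k) (sym (ℕP.+-suc n n)) ⟩
  A ^ₘ (suc n ℕ.+ suc n)           ∎

•ₘ-^ₘ : ∀ k M n → (k •ₘ M) ^ₘ n ≡ (k ^ n) •ₘ (M ^ₘ n)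
•ₘ-^ₘ k M zero    = sym (•ₘ-identityˡ Iₘ)
•ₘ-^ₘ k M (suc n) = trans (cong ((k •ₘ M) *ₘ_) (•ₘ-^ₘ k M n)) (•ₘ-*ₘ-•ₘ k (k ^ n) M (M ^ₘ n))

det≡1⇒det-^ₘ≡1 : ∀ {M} → det M ≡ 1ℚ → ∀ n → det (M ^ₘ n) ≡ 1ℚ
det≡1⇒det-^ₘ≡1 det≡1 zero    = refl
det≡1⇒det-^ₘ≡1 {M} det≡1 (suc n) = begin
  det (M *ₘ (M ^ₘ n))    ≡⟨ det-*ₘ M (M ^ₘ n) ⟩
  det M * det (M ^ₘ n)   ≡⟨ cong₂ _*_ det≡1 (det≡1⇒det-^ₘ≡1 det≡1 n) ⟩
  1ℚ * 1ℚ                ≡⟨⟩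
  1ℚ                     ∎

tr²≡tr-*ₘ-self : ∀ M → tr M * tr M ≡ tr (M *ₘ M) + (1ℚ + 1ℚ) * det M
tr²≡tr-*ₘ-self (mat a b c d) = identity a b c d
  where
  identity : ∀ a b c d →
    (a + d) * (a + d) ≡ ((a * a + b * c) + (c * b + d * d)) + (1ℚ + 1ℚ) * (a * d - b * c)
  identity = solve-∀ ℚ-ring

module Lucas {c ℓ} (R : RawRing c ℓ) where
  private module R = RawRing R

  lucasU lucasV : R.Carrier → R.Carrier → ℕ → R.Carrier
  lucasU P Q zero          = R.0#
  lucasU P Q (suc zero)    = R.1#
  lucasU P Q (suc (suc n)) = P R.* lucasU P Q (suc n) R.+ R.- (Q R.* lucasU P Q n)
  lucasV P Q zero          = R.1# R.+ R.1#
  lucasV P Q (suc zero)    = P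
  lucasV P Q (suc (suc n)) = P R.* lucasV P Q (suc n) R.+ R.- (Q R.* lucasV P Q n)

open Lucas ℚ.+-*-rawRing
open Lucas ℤ.+-*-rawRing renaming (lucasU to lucasUℤ; lucasV to lucasVℤ)

fromℤ-lucas-step : ∀ P Q x y →
  fromℤ (P ℤ.* x ℤ.+ ℤ.- (Q ℤ.* y)) ≡ fromℤ P * fromℤ x - fromℤ Q * fromℤ y
fromℤ-lucas-step P Q x y = begin
  fromℤ (P ℤ.* x ℤ.+ ℤ.- (Q ℤ.* y))         ≡⟨ fromℤ-homo-+ (P ℤ.* x) _ ⟩
  fromℤ (P ℤ.* x) + fromℤ (ℤ.- (Q ℤ.* y))   ≡⟨ cong₂ _+_ (fromℤ-homo-* P x) (fromℤ-homo‿- (Q ℤ.* y)) ⟩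
  fromℤ P * fromℤ x - fromℤ (Q ℤ.* y)       ≡⟨ cong (λ z → fromℤ P * fromℤ x - z) (fromℤ-homo-* Q y) ⟩
  fromℤ P * fromℤ x - fromℤ Q * fromℤ y     ∎

fromℤ-lucasU : ∀ P Q n → fromℤ (lucasUℤ P Q n) ≡ lucasU (fromℤ P) (fromℤ Q) n
fromℤ-lucasU P Q zero          = refl
fromℤ-lucasU P Q (suc zero)    = refl
fromℤ-lucasU P Q (suc (suc n)) = trans (fromℤ-lucas-step P Q _ _)
  (cong₂ (λ x y → fromℤ P * x - fromℤ Q * y) (fromℤ-lucasU P Q (suc n)) (fromℤ-lucasU P Q n))

fromℤ-lucasV : ∀ P Q n → fromℤ (lucasVℤ P Q n) ≡ lucasV (fromℤ P) (fromℤ Q) n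
fromℤ-lucasV P Q zero          = refl
fromℤ-lucasV P Q (suc zero)    = refl
fromℤ-lucasV P Q (suc (suc n)) = trans (fromℤ-lucas-step P Q _ _)
  (cong₂ (λ x y → fromℤ P * x - fromℤ Q * y) (fromℤ-lucasV P Q (suc n)) (fromℤ-lucasV P Q n))

lucasV-suc : ∀ P Q n →
  lucasV P Q (suc n) ≡ lucasU P Q (suc n) * P - (Q * lucasU P Q n + Q * lucasU P Q n)
lucasV-suc P Q zero          = base₁ P Q
  where
  base₁ : ∀ P Q → P ≡ 1ℚ * P - (Q * 0ℚ + Q * 0ℚ)
  base₁ = solve-∀ ℚ-ring
lucasV-suc P Q (suc zero)    = base₂ P Q
  where
  base₂ : ∀ P Q → P * P - Q * (1ℚ + 1ℚ) ≡ (P * 1ℚ - Q * 0ℚ) * P - (Q * 1ℚ + Q * 1ℚ)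
  base₂ = solve-∀ ℚ-ring
lucasV-suc P Q (suc (suc n)) =
  trans (cong₂ (λ x y → P * x - Q * y) (lucasV-suc P Q (suc n)) (lucasV-suc P Q n))
        (step P Q (lucasU P Q (suc n)) (lucasU P Q n))
  where
  step : ∀ P Q u₁ u₀ → let u₂ = P * u₁ - Q * u₀ in
    P * (u₂ * P - (Q * u₁ + Q * u₁)) - Q * (u₁ * P - (Q * u₀ + Q * u₀))
      ≡ (P * u₂ - Q * u₁) * P - (Q * u₂ + Q * u₂)
  step = solve-∀ ℚ-ring

^ₘ-one≡lucas : ∀ M → M ^ₘ 1 ≡ 1ℚ •ₘ M -ₘ (det M * 0ℚ) •ₘ Iₘ
^ₘ-one≡lucas M@(mat a b c d) =
  mat-cong (e₁₁ a b (det M)) (e₁₂ a b (det M)) (e₂₁ c d (det M)) (e₂₂ c d (det M))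
  where
  e₁₁ : ∀ x y D → x * 1ℚ + y * 0ℚ ≡ 1ℚ * x - (D * 0ℚ) * 1ℚ
  e₁₁ = solve-∀ ℚ-ring
  e₁₂ : ∀ x y D → x * 0ℚ + y * 1ℚ ≡ 1ℚ * y - (D * 0ℚ) * 0ℚ
  e₁₂ = solve-∀ ℚ-ring
  e₂₁ : ∀ x y D → x * 1ℚ + y * 0ℚ ≡ 1ℚ * x - (D * 0ℚ) * 0ℚ
  e₂₁ = solve-∀ ℚ-ring
  e₂₂ : ∀ x y D → x * 0ℚ + y * 1ℚ ≡ 1ℚ * y - (D * 0ℚ) * 1ℚ
  e₂₂ = solve-∀ ℚ-ring

cayleyHamilton : ∀ M p q →
  M *ₘ (p •ₘ M -ₘ q •ₘ Iₘ) ≡ (tr M * p - q) •ₘ M -ₘ (det M * p) •ₘ Iₘ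
cayleyHamilton (mat a b c d) p q =
  mat-cong (e₁₁ a b c d p q) (e₁₂ a b c d p q) (e₂₁ a b c d p q) (e₂₂ a b c d p q)
  where
  e₁₁ : ∀ a b c d p q →
    a * (p * a - q * 1ℚ) + b * (p * c - q * 0ℚ) ≡ ((a + d) * p - q) * a - ((a * d - b * c) * p) * 1ℚ
  e₁₁ = solve-∀ ℚ-ring
  e₁₂ : ∀ a b c d p q →
    a * (p * b - q * 0ℚ) + b * (p * d - q * 1ℚ) ≡ ((a + d) * p - q) * b - ((a * d - b * c) * p) * 0ℚ
  e₁₂ = solve-∀ ℚ-ring
  e₂₁ : ∀ a b c d p q →
    c * (p * a - q * 1ℚ) + d * (p * c - q * 0ℚ) ≡ ((a + d) * p - q) * c - ((a * d - b * c) * p) * 0ℚ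
  e₂₁ = solve-∀ ℚ-ring
  e₂₂ : ∀ a b c d p q →
    c * (p * b - q * 0ℚ) + d * (p * d - q * 1ℚ) ≡ ((a + d) * p - q) * d - ((a * d - b * c) * p) * 1ℚ
  e₂₂ = solve-∀ ℚ-ring

^ₘ-suc≡lucas : ∀ M n → let U = lucasU (tr M) (det M) in
  M ^ₘ suc n ≡ U (suc n) •ₘ M -ₘ (det M * U n) •ₘ Iₘ
^ₘ-suc≡lucas M zero    = ^ₘ-one≡lucas M
^ₘ-suc≡lucas M (suc n) = trans (cong (M *ₘ_) (^ₘ-suc≡lucas M n)) (cayleyHamilton M _ _)

tr-[p•M-q•I] : ∀ p q M → tr (p •ₘ M -ₘ q •ₘ Iₘ) ≡ p * tr M - (q + q)
tr-[p•M-q•I] p q (mat a _ _ d) = identity p q a d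
  where
  identity : ∀ p q a d → (p * a - q * 1ℚ) + (p * d - q * 1ℚ) ≡ p * (a + d) - (q + q)
  identity = solve-∀ ℚ-ring

tr-^ₘ≡lucasV : ∀ M n → tr (M ^ₘ n) ≡ lucasV (tr M) (det M) n
tr-^ₘ≡lucasV M zero    = refl
tr-^ₘ≡lucasV M (suc n) = begin
  tr (M ^ₘ suc n)                       ≡⟨ cong tr (^ₘ-suc≡lucas M n) ⟩
  tr (U (suc n) •ₘ M -ₘ (D * U n) •ₘ Iₘ) ≡⟨ tr-[p•M-q•I] (U (suc n)) (D * U n) M ⟩
  U (suc n) * tr M - (D * U n + D * U n) ≡⟨ sym (lucasV-suc (tr M) D n) ⟩
  lucasV (tr M) D (suc n)               ∎
  where
  D = det M
  U = lucasU (tr M) D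

module _ (N : ℕ) .{{_ : ℕ.NonZero N}} where

  residue : ℤ → Fin N
  residue x = fromℕ< (n%ℕd<d x N)

  residue≡⇒∣- : ∀ x y → residue x ≡ residue y → + N ∣ x ℤ.- y
  residue≡⇒∣- x y eq = divides (x /ℕ N ℤ.- y /ℕ N) (begin
    x ℤ.- y                                            ≡⟨ cong₂ ℤ._-_ (a≡a%ℕn+[a/ℕn]*n x N) y≡ ⟩
    (ρ ℤ.+ x /ℕ N ℤ.* + N) ℤ.- (ρ ℤ.+ y /ℕ N ℤ.* + N) ≡⟨ cancel ρ (x /ℕ N) (y /ℕ N) (+ N) ⟩
    (x /ℕ N ℤ.- y /ℕ N) ℤ.* + N                        ∎)
    where
    ρ = + (x %ℕ N)
    x%N≡y%N : x %ℕ N ≡ y %ℕ N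
    x%N≡y%N = trans (sym (FinP.toℕ-fromℕ< (n%ℕd<d x N))) (trans (cong toℕ eq) (FinP.toℕ-fromℕ< (n%ℕd<d y N)))
    y≡ : y ≡ ρ ℤ.+ y /ℕ N ℤ.* + N
    y≡ = trans (a≡a%ℕn+[a/ℕn]*n y N) (cong (λ r → + r ℤ.+ y /ℕ N ℤ.* + N) (sym x%N≡y%N))
    cancel : ∀ ρ a b n → (ρ ℤ.+ a ℤ.* n) ℤ.- (ρ ℤ.+ b ℤ.* n) ≡ (a ℤ.- b) ℤ.* n
    cancel = ℤ-Solver.solve-∀

  module _ (P : ℤ) where
    private u = lucasUℤ P (+ 1)

    lucasU-mod-step-back : ∀ i j → + N ∣ u (suc i) ℤ.- u (suc j) →
                           + N ∣ u (suc (suc i)) ℤ.- u (suc (suc j)) → + N ∣ u i ℤ.- u j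
    lucasU-mod-step-back i j ∣₁ ∣₂ =
      subst (+ N ∣_) (sym (identity P (u (suc i)) (u i) (u (suc j)) (u j))) (∣m∣n⇒∣m-n (∣n⇒∣m*n P ∣₁) ∣₂)
      where
      identity : ∀ P x₁ x₀ y₁ y₀ → x₀ ℤ.- y₀ ≡
        P ℤ.* (x₁ ℤ.- y₁) ℤ.- ((P ℤ.* x₁ ℤ.- + 1 ℤ.* x₀) ℤ.- (P ℤ.* y₁ ℤ.- + 1 ℤ.* y₀))
      identity = ℤ-Solver.solve-∀

    lucasU-mod-descend : ∀ i k → + N ∣ u i ℤ.- u (i ℕ.+ k) → + N ∣ u (suc i) ℤ.- u (suc i ℕ.+ k) →
                         + N ∣ u 0 ℤ.- u k
    lucasU-mod-descend zero    k ∣₀ _  = ∣₀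
    lucasU-mod-descend (suc i) k ∣₁ ∣₂ =
      lucasU-mod-descend i k (lucasU-mod-step-back i (i ℕ.+ k) ∣₁ ∣₂) ∣₁

    residuePair : Fin (suc (N ℕ.* N)) → Fin (N ℕ.* N)
    residuePair i = combine (residue (u (toℕ i))) (residue (u (suc (toℕ i))))

    -- By pigeonhole some pair (uᵢ, uᵢ₊₁) recurs modulo N; running the recurrence backwards
    -- (possible since Q = 1) shows that (u₀, u₁) = (0, 1) recurs too.
    lucasU-vanishes-mod : ∃ λ m → + N ∣ u (suc m)
    lucasU-vanishes-mod with FinP.pigeonhole (ℕP.n<1+n (N ℕ.* N)) residuePair
    ... | i , j , i<j , eq = k , N∣u
      where
      k = toℕ j ℕ.∸ suc (toℕ i)
      j≡i+k : toℕ j ≡ toℕ i ℕ.+ suc k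
      j≡i+k = trans (sym (ℕP.m+[n∸m]≡n i<j)) (sym (ℕP.+-suc (toℕ i) k))
      residues≡ : residue (u (toℕ i)) ≡ residue (u (toℕ j))
                × residue (u (suc (toℕ i))) ≡ residue (u (suc (toℕ j)))
      residues≡ = FinP.combine-injective _ _ _ _ eq
      N∣u₀ : + N ∣ u (toℕ i) ℤ.- u (toℕ i ℕ.+ suc k)
      N∣u₀ = subst (λ t → + N ∣ u (toℕ i) ℤ.- u t) j≡i+k
                   (residue≡⇒∣- (u (toℕ i)) (u (toℕ j)) (proj₁ residues≡))
      N∣u₁ : + N ∣ u (suc (toℕ i)) ℤ.- u (suc (toℕ i) ℕ.+ suc k)
      N∣u₁ = subst (λ t → + N ∣ u (suc (toℕ i)) ℤ.- u (suc t)) j≡i+k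
                   (residue≡⇒∣- (u (suc (toℕ i))) (u (suc (toℕ j))) (proj₂ residues≡))
      N∣u : + N ∣ u (suc k)
      N∣u = subst (+ N ∣_) (identity (u (suc k)))
                  (∣m⇒∣-m (lucasU-mod-descend (toℕ i) (suc k) N∣u₀ N∣u₁))
        where
        identity : ∀ x → ℤ.- (+ 0 ℤ.- x) ≡ x
        identity = ℤ-Solver.solve-∀

IsIntegralₘ : M2 ℚ → Set
IsIntegralₘ (mat a b c d) = IsInteger a × IsInteger b × IsInteger c × IsInteger d

IsIntegralₘ⇒toℚₘ : ∀ M → IsIntegralₘ M → ∃ λ B → M ≡ toℚₘ B
IsIntegralₘ⇒toℚₘ (mat _ _ _ _) ((a , refl) , (b , refl) , (c , refl) , (d , refl)) = mat a b c d , refl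

IsIntegralₘ-toℚₘ : ∀ B → IsIntegralₘ (toℚₘ B)
IsIntegralₘ-toℚₘ (mat a b c d) = IsInteger-fromℤ a , IsInteger-fromℤ b , IsInteger-fromℤ c , IsInteger-fromℤ d

IsIntegralₘ-Iₘ : IsIntegralₘ Iₘ
IsIntegralₘ-Iₘ = IsInteger-fromℤ (+ 1) , IsInteger-fromℤ (+ 0) , IsInteger-fromℤ (+ 0) , IsInteger-fromℤ (+ 1)

IsIntegralₘ-*ₘ : ∀ M N → IsIntegralₘ M → IsIntegralₘ N → IsIntegralₘ (M *ₘ N)
IsIntegralₘ-*ₘ (mat _ _ _ _) (mat _ _ _ _) (a , b , c , d) (e , f , g , h) =
  IsInteger-+ (IsInteger-* a e) (IsInteger-* b g) , IsInteger-+ (IsInteger-* a f) (IsInteger-* b h) ,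
  IsInteger-+ (IsInteger-* c e) (IsInteger-* d g) , IsInteger-+ (IsInteger-* c f) (IsInteger-* d h)

IsIntegralₘ-minus : ∀ M N → IsIntegralₘ M → IsIntegralₘ N → IsIntegralₘ (M -ₘ N)
IsIntegralₘ-minus (mat _ _ _ _) (mat _ _ _ _) (a , b , c , d) (e , f , g , h) =
  IsInteger-+ a (IsInteger-neg e) , IsInteger-+ b (IsInteger-neg f) ,
  IsInteger-+ c (IsInteger-neg g) , IsInteger-+ d (IsInteger-neg h)

IsIntegralₘ-•ₘ : ∀ {k} M → IsInteger k → IsIntegralₘ M → IsIntegralₘ (k •ₘ M)
IsIntegralₘ-•ₘ (mat _ _ _ _) k (a , b , c , d) = IsInteger-* k a , IsInteger-* k b , IsInteger-* k c , IsInteger-* k d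

IsInteger-tr : ∀ M → IsIntegralₘ M → IsInteger (tr M)
IsInteger-tr (mat _ _ _ _) (a , _ , _ , d) = IsInteger-+ a d

commonDenominator : M2 ℚ → ℕ
commonDenominator (mat a b c d) = ↧ₙ a ℕ.* ↧ₙ b ℕ.* ↧ₙ c ℕ.* ↧ₙ d

commonDenominator-nonZero : ∀ M → ℕ.NonZero (commonDenominator M)
commonDenominator-nonZero (mat _ _ _ _) = _

IsIntegralₘ-•ₘ-commonDenominator : ∀ M {k} → + commonDenominator M ∣ k → IsIntegralₘ (fromℤ k •ₘ M)
IsIntegralₘ-•ₘ-commonDenominator (mat a b c d) N∣k =
  ↧∣⇒IsInteger-* a (through {a} (ℕD.∣m⇒∣m*n (↧ₙ d) (ℕD.∣m⇒∣m*n (↧ₙ c) (ℕD.m∣m*n (↧ₙ b))))) ,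
  ↧∣⇒IsInteger-* b (through {b} (ℕD.∣m⇒∣m*n (↧ₙ d) (ℕD.∣m⇒∣m*n (↧ₙ c) (ℕD.n∣m*n (↧ₙ a))))) ,
  ↧∣⇒IsInteger-* c (through {c} (ℕD.∣m⇒∣m*n (↧ₙ d) (ℕD.n∣m*n (↧ₙ a ℕ.* ↧ₙ b)))) ,
  ↧∣⇒IsInteger-* d (through {d} (ℕD.n∣m*n (↧ₙ a ℕ.* ↧ₙ b ℕ.* ↧ₙ c)))
  where
  through : ∀ {x} → ↧ₙ x ℕD.∣ commonDenominator (mat a b c d) → ↧ x ∣ _
  through x∣N = ∣-trans (∣ᵤ⇒∣ x∣N) N∣k

det-toℚₘ : ∀ B → det (toℚₘ B) ≡ fromℤ (detℤ B)
det-toℚₘ (mat a b c d) = sym (begin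
  fromℤ (a ℤ.* d ℤ.+ ℤ.- (b ℤ.* c))          ≡⟨ fromℤ-homo-+ (a ℤ.* d) _ ⟩
  fromℤ (a ℤ.* d) + fromℤ (ℤ.- (b ℤ.* c))    ≡⟨ cong₂ _+_ (fromℤ-homo-* a d) (fromℤ-homo‿- (b ℤ.* c)) ⟩
  fromℤ a * fromℤ d - fromℤ (b ℤ.* c)        ≡⟨ cong (λ x → fromℤ a * fromℤ d - x) (fromℤ-homo-* b c) ⟩
  fromℤ a * fromℤ d - fromℤ b * fromℤ c      ∎)

det≡1∧IsInteger-tr⇒^ₘ≡toℚₘ : ∀ C → det C ≡ 1ℚ → IsInteger (tr C) → ∃₂ λ m B → C ^ₘ suc m ≡ toℚₘ B
det≡1∧IsInteger-tr⇒^ₘ≡toℚₘ C det≡1 (s , tr≡s) =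
  fromVanishing (lucasU-vanishes-mod (commonDenominator C) {{commonDenominator-nonZero C}} s)
  where
  U = lucasU (tr C) (det C)
  U≡ : ∀ n → U n ≡ fromℤ (lucasUℤ s (+ 1) n)
  U≡ n = trans (cong₂ (λ P Q → lucasU P Q n) tr≡s det≡1) (sym (fromℤ-lucasU s (+ 1) n))
  fromVanishing : (∃ λ m → + commonDenominator C ∣ lucasUℤ s (+ 1) (suc m)) → ∃₂ λ m B → C ^ₘ suc m ≡ toℚₘ B
  fromVanishing (m , N∣Uₘ₊₁) =
    m , IsIntegralₘ⇒toℚₘ (C ^ₘ suc m)
          (subst IsIntegralₘ (sym (^ₘ-suc≡lucas C m))
                 (IsIntegralₘ-minus (U (suc m) •ₘ C) ((det C * U m) •ₘ Iₘ) scaled identityPart))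
    where
    scaled : IsIntegralₘ (U (suc m) •ₘ C)
    scaled = subst (λ x → IsIntegralₘ (x •ₘ C)) (sym (U≡ (suc m)))
                   (IsIntegralₘ-•ₘ-commonDenominator C N∣Uₘ₊₁)
    identityPart : IsIntegralₘ ((det C * U m) •ₘ Iₘ)
    identityPart = IsIntegralₘ-•ₘ Iₘ (IsInteger-* (+ 1 , det≡1) (lucasUℤ s (+ 1) m , U≡ m)) IsIntegralₘ-Iₘ

lucasV-scale : ∀ c P Q n → lucasV (c * P) (c * c * Q) n ≡ c ^ n * lucasV P Q n
lucasV-scale c P Q zero          = sym (ℚP.*-identityˡ (1ℚ + 1ℚ))
lucasV-scale c P Q (suc zero)    = cong (_* P) (sym (ℚP.*-identityʳ c))
lucasV-scale c P Q (suc (suc n)) =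
  trans (cong₂ (λ x y → c * P * x - c * c * Q * y) (lucasV-scale c P Q (suc n)) (lucasV-scale c P Q n))
        (identity c P Q (c ^ n) (lucasV P Q (suc n)) (lucasV P Q n))
  where
  identity : ∀ c P Q cⁿ v₁ v₀ →
    c * P * (c * cⁿ * v₁) - c * c * Q * (cⁿ * v₀) ≡ c * (c * cⁿ) * (P * v₁ - Q * v₀)
  identity = solve-∀ ℚ-ring

fromℤ-homo-^ : ∀ i n → fromℤ (i ℤ.^ n) ≡ fromℤ i ^ n
fromℤ-homo-^ i zero    = refl
fromℤ-homo-^ i (suc n) = trans (fromℤ-homo-* i (i ℤ.^ n)) (cong (fromℤ i *_) (fromℤ-homo-^ i n))

lucasVℤ≡^-mod : ∀ {q} P Q → q ∣ Q → ∀ n → q ∣ lucasVℤ P Q (suc n) ℤ.- P ℤ.^ suc n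
lucasVℤ≡^-mod P Q q∣Q zero = subst (_ ∣_) (identity P Q) (∣m⇒∣m*n (+ 0) q∣Q)
  where
  identity : ∀ P Q → Q ℤ.* + 0 ≡ P ℤ.- P ℤ.* + 1
  identity = ℤ-Solver.solve-∀
lucasVℤ≡^-mod P Q q∣Q (suc zero) = subst (_ ∣_) (identity P Q) (∣m⇒∣m*n (ℤ.- + 2) q∣Q)
  where
  identity : ∀ P Q → Q ℤ.* ℤ.- + 2 ≡ (P ℤ.* P ℤ.- Q ℤ.* (+ 1 ℤ.+ + 1)) ℤ.- P ℤ.* (P ℤ.* + 1)
  identity = ℤ-Solver.solve-∀
lucasVℤ≡^-mod P Q q∣Q (suc (suc n)) =
  subst (_ ∣_) (identity P Q (lucasVℤ P Q (suc (suc n))) (lucasVℤ P Q (suc n)) (P ℤ.^ suc (suc n)))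
        (∣m∣n⇒∣m-n (∣n⇒∣m*n P (lucasVℤ≡^-mod P Q q∣Q (suc n))) (∣m⇒∣m*n (lucasVℤ P Q (suc n)) q∣Q))
  where
  identity : ∀ P Q v₂ v₁ x → P ℤ.* (v₂ ℤ.- x) ℤ.- Q ℤ.* v₁ ≡ (P ℤ.* v₂ ℤ.- Q ℤ.* v₁) ℤ.- P ℤ.* x
  identity = ℤ-Solver.solve-∀

coprime-∣-^⇒∣1 : ∀ {i j} → Coprime i j → ∀ n → i ℤᵘ.∣ j ℤ.^ n → i ℤᵘ.∣ + 1
coprime-∣-^⇒∣1 i⊥j zero    i∣1     = i∣1
coprime-∣-^⇒∣1 {i} {j} i⊥j (suc n) i∣jʲⁿ =
  coprime-∣-^⇒∣1 {i} {j} i⊥j n (coprime-divisor i j (j ℤ.^ n) i⊥j i∣jʲⁿ)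

↧∣↥^⇒IsInteger : ∀ r n → ↧ r ∣ ↥ r ℤ.^ n → IsInteger r
↧∣↥^⇒IsInteger r@(mkℚ p d p⊥d) n ↧∣↥ⁿ =
  ↧ₙ≡1⇒IsInteger r (ℕD.∣1⇒≡1 (coprime-∣-^⇒∣1 {↧ r} {p} ↧⊥↥ n (∣⇒∣ᵤ ↧∣↥ⁿ)))
  where
  ↧⊥↥ : Coprime (↧ r) p
  ↧⊥↥ = recompute (ℕC.coprime? _ _) (ℕC.sym p⊥d)

IsInteger-lucasV⇒IsInteger : ∀ y Q n → IsInteger (lucasV y (fromℤ Q) (suc n)) → IsInteger y
IsInteger-lucasV⇒IsInteger y Q n (z , V≡z) = ↧∣↥^⇒IsInteger y (suc n) q∣pⁿ
  where
  p = ↥ y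
  q = ↧ y
  Vℤ = lucasVℤ p (q ℤ.* q ℤ.* Q) (suc n)
  p≡qy : fromℤ p ≡ fromℤ q * y
  p≡qy = trans (sym (*-fromℤ-↧≡fromℤ-↥ y)) (ℚP.*-comm y (fromℤ q))
  qqQ≡ : fromℤ (q ℤ.* q ℤ.* Q) ≡ fromℤ q * fromℤ q * fromℤ Q
  qqQ≡ = trans (fromℤ-homo-* (q ℤ.* q) Q) (cong (_* fromℤ Q) (fromℤ-homo-* q q))
  Vℤ≡ : Vℤ ≡ q ℤ.^ suc n ℤ.* z
  Vℤ≡ = fromℤ-injective (begin
    fromℤ Vℤ                                                   ≡⟨ fromℤ-lucasV p _ (suc n) ⟩
    lucasV (fromℤ p) (fromℤ (q ℤ.* q ℤ.* Q)) (suc n)           ≡⟨ cong₂ (λ P Q → lucasV P Q (suc n)) p≡qy qqQ≡ ⟩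
    lucasV (fromℤ q * y) (fromℤ q * fromℤ q * fromℤ Q) (suc n) ≡⟨ lucasV-scale (fromℤ q) y (fromℤ Q) (suc n) ⟩
    fromℤ q ^ suc n * lucasV y (fromℤ Q) (suc n)               ≡⟨ cong₂ _*_ (sym (fromℤ-homo-^ q (suc n))) V≡z ⟩
    fromℤ (q ℤ.^ suc n) * fromℤ z                              ≡⟨ sym (fromℤ-homo-* (q ℤ.^ suc n) z) ⟩
    fromℤ (q ℤ.^ suc n ℤ.* z)                                  ∎)
  q∣Vℤ : q ∣ Vℤ
  q∣Vℤ = subst (q ∣_) (sym Vℤ≡) (∣m⇒∣m*n z (∣m⇒∣m*n (q ℤ.^ n) ∣-refl))
  q∣Vℤ-pⁿ : q ∣ Vℤ ℤ.- p ℤ.^ suc n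
  q∣Vℤ-pⁿ = lucasVℤ≡^-mod p _ (∣m⇒∣m*n Q (∣m⇒∣m*n q ∣-refl)) n
  q∣pⁿ : q ∣ p ℤ.^ suc n
  q∣pⁿ = subst (q ∣_) (identity Vℤ (p ℤ.^ suc n)) (∣m∣n⇒∣m-n q∣Vℤ q∣Vℤ-pⁿ)
    where
    identity : ∀ v x → v ℤ.- (v ℤ.- x) ≡ x
    identity = ℤ-Solver.solve-∀

-- y² = V₂(y, 0)
IsInteger-*-self⇒IsInteger : ∀ y → IsInteger (y * y) → IsInteger y
IsInteger-*-self⇒IsInteger y y²∈ℤ =
  IsInteger-lucasV⇒IsInteger y (+ 0) 1 (subst IsInteger (identity y) y²∈ℤ)
  where
  identity : ∀ y → y * y ≡ y * y - 0ℚ * (1ℚ + 1ℚ)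
  identity = solve-∀ ℚ-ring

det≡fromℤ∧IsInteger-tr-^ₘ⇒IsInteger-tr : ∀ C Q n → det C ≡ fromℤ Q →
  IsInteger (tr (C ^ₘ suc n)) → IsInteger (tr C)
det≡fromℤ∧IsInteger-tr-^ₘ⇒IsInteger-tr C Q n det≡Q trCⁿ∈ℤ = IsInteger-lucasV⇒IsInteger (tr C) Q n
  (subst IsInteger (trans (tr-^ₘ≡lucasV C (suc n)) (cong (λ D → lucasV (tr C) D (suc n)) det≡Q)) trCⁿ∈ℤ)

det≡1⇒InGL2ℤ : ∀ B → det (toℚₘ B) ≡ 1ℚ → InGL2ℤ B
det≡1⇒InGL2ℤ B det≡1 = inj₁ (fromℤ-injective (trans (sym (det-toℚₘ B)) det≡1))

InGL2ℤ⇒det-*ₘ-self≡1 : ∀ B → InGL2ℤ B → det (toℚₘ B *ₘ toℚₘ B) ≡ 1ℚ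
InGL2ℤ⇒det-*ₘ-self≡1 B det≡±1 = begin
  det (toℚₘ B *ₘ toℚₘ B)                  ≡⟨ det-*ₘ (toℚₘ B) (toℚₘ B) ⟩
  det (toℚₘ B) * det (toℚₘ B)             ≡⟨ cong (λ x → x * x) (det-toℚₘ B) ⟩
  fromℤ (detℤ B) * fromℤ (detℤ B)         ≡⟨ square≡1 det≡±1 ⟩
  1ℚ                                      ∎
  where
  square≡1 : InGL2ℤ B → fromℤ (detℤ B) * fromℤ (detℤ B) ≡ 1ℚ
  square≡1 (inj₁ det≡1)  rewrite det≡1  = refl
  square≡1 (inj₂ det≡-1) rewrite det≡-1 = refl

•ₘ-SL₂ℤ⇒IsInteger-tr : ∀ {M} k X → det M ≡ 1ℚ → M ≡ k •ₘ X → IsIntegralₘ X → det X ≡ 1ℚ →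
                        IsInteger (tr M)
•ₘ-SL₂ℤ⇒IsInteger-tr {M} k X detM≡1 M≡kX X∈ℤ detX≡1 =
  subst IsInteger (sym (trans (cong tr M≡kX) (tr-•ₘ k X))) (IsInteger-* k∈ℤ (IsInteger-tr X X∈ℤ))
  where
  k²≡1 : k * k ≡ 1ℚ
  k²≡1 = begin
    k * k            ≡⟨ sym (ℚP.*-identityʳ (k * k)) ⟩
    k * k * 1ℚ       ≡⟨ cong (k * k *_) (sym detX≡1) ⟩
    k * k * det X    ≡⟨ sym (det-•ₘ k X) ⟩
    det (k •ₘ X)     ≡⟨ cong det (sym M≡kX) ⟩
    det M            ≡⟨ detM≡1 ⟩
    1ℚ               ∎
  k∈ℤ : IsInteger k
  k∈ℤ = IsInteger-*-self⇒IsInteger k (subst IsInteger (sym k²≡1) (IsInteger-fromℤ (+ 1)))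

PowerInℚGL₂ℤ : M2 ℚ → Set
PowerInℚGL₂ℤ A = ∃ λ n → n ≥ 1 × (∃ λ r → ∃ λ B → InGL2ℤ B × (A ^ₘ n ≡ r •ₘ toℚₘ B))

module _ (A : M2 ℚ) (h : InGL2ℚ A) where
  private instance
    det≢0 : ℚ.NonZero (det A)
    det≢0 = ≢-nonZero h

  normalisedSquare : M2 ℚ
  normalisedSquare = (1/ det A) •ₘ (A *ₘ A)

  private
    w : ℚ
    w = 1/ det A

    C : M2 ℚ
    C = normalisedSquare

  det-normalisedSquare : det C ≡ 1ℚ
  det-normalisedSquare = begin
    det (w •ₘ (A *ₘ A))           ≡⟨ det-•ₘ w (A *ₘ A) ⟩
    w * w * det (A *ₘ A)          ≡⟨ cong (w * w *_) (det-*ₘ A A) ⟩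
    w * w * (det A * det A)       ≡⟨ identity w (det A) ⟩
    (det A * w) * (det A * w)     ≡⟨ cong (λ x → x * x) (ℚP.*-inverseʳ (det A)) ⟩
    1ℚ                            ∎
    where
    identity : ∀ w D → w * w * (D * D) ≡ (D * w) * (D * w)
    identity = solve-∀ ℚ-ring

  trSqOverDet≡tr-normalisedSquare+2 : trSqOverDet A h ≡ tr C + (1ℚ + 1ℚ)
  trSqOverDet≡tr-normalisedSquare+2 = begin
    tr A * tr A * w                              ≡⟨ cong (_* w) (tr²≡tr-*ₘ-self A) ⟩
    (tr (A *ₘ A) + (1ℚ + 1ℚ) * det A) * w        ≡⟨ identity (tr (A *ₘ A)) (det A) w ⟩
    w * tr (A *ₘ A) + (1ℚ + 1ℚ) * (det A * w)    ≡⟨ cong₂ (λ x y → x + (1ℚ + 1ℚ) * y)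
                                                          (sym (tr-•ₘ w (A *ₘ A))) (ℚP.*-inverseʳ (det A)) ⟩
    tr C + (1ℚ + 1ℚ) * 1ℚ                        ≡⟨ cong (λ x → tr C + x) (ℚP.*-identityʳ (1ℚ + 1ℚ)) ⟩
    tr C + (1ℚ + 1ℚ)                             ∎
    where
    identity : ∀ t D w → (t + (1ℚ + 1ℚ) * D) * w ≡ w * t + (1ℚ + 1ℚ) * (D * w)
    identity = solve-∀ ℚ-ring

  IsInteger-trSqOverDet⇔IsInteger-tr : IsInteger (trSqOverDet A h) ⇔ IsInteger (tr C)
  IsInteger-trSqOverDet⇔IsInteger-tr = mk⇔
    (λ x∈ℤ → subst IsInteger (cancel (tr C))
      (subst (λ x → IsInteger (x - (1ℚ + 1ℚ))) trSqOverDet≡tr-normalisedSquare+2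
             (IsInteger-+ x∈ℤ (IsInteger-neg 2∈ℤ))))
    (λ t∈ℤ → subst IsInteger (sym trSqOverDet≡tr-normalisedSquare+2) (IsInteger-+ t∈ℤ 2∈ℤ))
    where
    2∈ℤ : IsInteger (1ℚ + 1ℚ)
    2∈ℤ = + 2 , refl
    cancel : ∀ t → t + (1ℚ + 1ℚ) - (1ℚ + 1ℚ) ≡ t
    cancel = solve-∀ ℚ-ring

  *ₘ-self≡det•ₘnormalisedSquare : A *ₘ A ≡ det A •ₘ C
  *ₘ-self≡det•ₘnormalisedSquare = sym (begin
    det A •ₘ (w •ₘ (A *ₘ A))    ≡⟨ •ₘ-assoc (det A) w (A *ₘ A) ⟩
    (det A * w) •ₘ (A *ₘ A)     ≡⟨ cong (_•ₘ (A *ₘ A)) (ℚP.*-inverseʳ (det A)) ⟩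
    1ℚ •ₘ (A *ₘ A)              ≡⟨ •ₘ-identityˡ (A *ₘ A) ⟩
    A *ₘ A                      ∎)

  ^ₘ-+-self≡•ₘnormalisedSquare-^ₘ : ∀ n → A ^ₘ (n ℕ.+ n) ≡ (det A ^ n) •ₘ (C ^ₘ n)
  ^ₘ-+-self≡•ₘnormalisedSquare-^ₘ n = begin
    A ^ₘ (n ℕ.+ n)               ≡⟨ sym (*ₘ-self-^ₘ A n) ⟩
    (A *ₘ A) ^ₘ n                ≡⟨ cong (_^ₘ n) *ₘ-self≡det•ₘnormalisedSquare ⟩
    (det A •ₘ C) ^ₘ n            ≡⟨ •ₘ-^ₘ (det A) C n ⟩
    (det A ^ n) •ₘ (C ^ₘ n)      ∎

  normalisedSquare-^ₘ-•ₘ : ∀ n r M → A ^ₘ n ≡ r •ₘ M → C ^ₘ n ≡ ((1/ det A) ^ n * (r * r)) •ₘ (M *ₘ M)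
  normalisedSquare-^ₘ-•ₘ n r M Aⁿ≡rM = begin
    (w •ₘ (A *ₘ A)) ^ₘ n                    ≡⟨ •ₘ-^ₘ w (A *ₘ A) n ⟩
    (w ^ n) •ₘ ((A *ₘ A) ^ₘ n)              ≡⟨ cong ((w ^ n) •ₘ_) (trans (*ₘ-self-^ₘ A n) (^ₘ-+ A n n)) ⟩
    (w ^ n) •ₘ ((A ^ₘ n) *ₘ (A ^ₘ n))       ≡⟨ cong (λ P → (w ^ n) •ₘ (P *ₘ P)) Aⁿ≡rM ⟩
    (w ^ n) •ₘ ((r •ₘ M) *ₘ (r •ₘ M))       ≡⟨ cong ((w ^ n) •ₘ_) (•ₘ-*ₘ-•ₘ r r M M) ⟩
    (w ^ n) •ₘ ((r * r) •ₘ (M *ₘ M))        ≡⟨ •ₘ-assoc (w ^ n) (r * r) (M *ₘ M) ⟩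
    (w ^ n * (r * r)) •ₘ (M *ₘ M)           ∎

  IsInteger-tr⇒PowerInℚGL₂ℤ : IsInteger (tr C) → PowerInℚGL₂ℤ A
  IsInteger-tr⇒PowerInℚGL₂ℤ trC∈ℤ = fromPower (det≡1∧IsInteger-tr⇒^ₘ≡toℚₘ C det-normalisedSquare trC∈ℤ)
    where
    fromPower : (∃₂ λ m B → C ^ₘ suc m ≡ toℚₘ B) → PowerInℚGL₂ℤ A
    fromPower (m , B , Cᵐ⁺¹≡B) =
      suc m ℕ.+ suc m , s≤s z≤n , det A ^ suc m , B , det≡1⇒InGL2ℤ B detB≡1 ,
      trans (^ₘ-+-self≡•ₘnormalisedSquare-^ₘ (suc m)) (cong ((det A ^ suc m) •ₘ_) Cᵐ⁺¹≡B)
      where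
      detB≡1 : det (toℚₘ B) ≡ 1ℚ
      detB≡1 = trans (cong det (sym Cᵐ⁺¹≡B)) (det≡1⇒det-^ₘ≡1 {C} det-normalisedSquare (suc m))

  PowerInℚGL₂ℤ⇒IsInteger-tr : PowerInℚGL₂ℤ A → IsInteger (tr C)
  PowerInℚGL₂ℤ⇒IsInteger-tr (suc m , _ , r , B , B∈GL₂ℤ , Aᵐ⁺¹≡rB) =
    det≡fromℤ∧IsInteger-tr-^ₘ⇒IsInteger-tr C (+ 1) m det-normalisedSquare
      (•ₘ-SL₂ℤ⇒IsInteger-tr (w ^ suc m * (r * r)) (toℚₘ B *ₘ toℚₘ B)
        (det≡1⇒det-^ₘ≡1 {C} det-normalisedSquare (suc m))
        (normalisedSquare-^ₘ-•ₘ (suc m) r (toℚₘ B) Aᵐ⁺¹≡rB)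
        (IsIntegralₘ-*ₘ (toℚₘ B) (toℚₘ B) (IsIntegralₘ-toℚₘ B) (IsIntegralₘ-toℚₘ B))
        (InGL2ℤ⇒det-*ₘ-self≡1 B B∈GL₂ℤ))

lemma2p3 : (A : M2 ℚ) (h : InGL2ℚ A) →
    IsInteger (trSqOverDet A h) ⇔
      (∃ λ (n : ℕ) → n ≥ 1 × (∃ λ (r : ℚ) → ∃ λ (B : M2 ℤ) → InGL2ℤ B × (A ^ₘ n ≡ r •ₘ toℚₘ B)))
lemma2p3 A h = mk⇔ (IsInteger-tr⇒PowerInℚGL₂ℤ A h ∘ to) (from ∘ PowerInℚGL₂ℤ⇒IsInteger-tr A h)
  where open Equivalence (IsInteger-trSqOverDet⇔IsInteger-tr A h)
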